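{- For integers $s,t\geq 5$ with $\max\{s,t\}\geq 6$, $\dim_s(\overline{C}_s\diamond\overline{C}_t)=st-\left\lfloor \frac{s}{2}\right\rfloor\left\lfloor \frac{t}{2}\right\rfloor$. In addition, $\dim_s(\overline{C}_5\diamond\overline{C}_5)=20$.
   Context: $\overline{C}_n$ is the complement of the cycle $C_n$. The modular product $G\diamond H$ has vertex set $V(G)\times V(H)$, and $(g,h)$, $(g',h')$ are adjacent if $g=g'$ and $hh'\in E(H)$, or $gg'\in E(G)$ and $h=h'$, or $gg'\in E(G)$ and $hh'\in E(H)$, or ($g\neq g'$, $h\neq h'$, $gg'\notin E(G)$ and $hh'\notin E(H)$). For a connected graph $X$, a vertex $z$ strongly resolves distinct vertices $x,y$ if $d_X(y,z)=d_X(y,x)+d_X(x,z)$ or $d_X(x,z)=d_X(x,y)+d_X(y,z)$; $\dim_s(X)$ is the minimum cardinality of a set $S\subseteq V(X)$ such that every two distinct vertices are strongly resolved by some vertex of $S$. -}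

module Defs where

open import Level using (0ℓ)
open import Data.Nat using (ℕ; zero; suc; _+_; _≤_)
open import Data.Fin using (Fin; toℕ)
open import Data.Product using (Σ; _×_; _,_; ∃-syntax)
open import Data.Sum using (_⊎_)
open import Data.List using (List; length)
open import Data.List.Relation.Unary.Any using (Any)
open import Data.List.Relation.Unary.Unique.Propositional using (Unique)
open import Relation.Binary.PropositionalEquality using (_≡_; _≢_)
open import Relation.Nullary using (¬_)

record Graph : Set₁ where
  field
    V   : Set
    Adj : V → V → Set
open Graph public

CycAdj : (n : ℕ) → Fin n → Fin n → Set
CycAdj n x y =
    (toℕ y ≡ suc (toℕ x))
  ⊎ (toℕ x ≡ suc (toℕ y))
  ⊎ (toℕ x ≡ 0 × suc (toℕ y) ≡ n)
  ⊎ (toℕ y ≡ 0 × suc (toℕ x) ≡ n)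

coCycle : ℕ → Graph
coCycle n = record
  { V   = Fin n
  ; Adj = λ x y → x ≢ y × ¬ CycAdj n x y }

_◇_ : Graph → Graph → Graph
G ◇ H = record
  { V   = V G × V H
  ; Adj = λ { (g , h) (g' , h') →
        (g ≡ g' × Adj H h h')
      ⊎ (Adj G g g' × h ≡ h')
      ⊎ (Adj G g g' × Adj H h h')
      ⊎ (g ≢ g' × h ≢ h' × ¬ Adj G g g' × ¬ Adj H h h') } }

data Walk (G : Graph) : V G → V G → ℕ → Set where
  nil  : ∀ {x} → Walk G x x 0
  cons : ∀ {x z y k} → Adj G x z → Walk G z y k → Walk G x y (suc k)

Dist : (G : Graph) → V G → V G → ℕ → Set
Dist G x y d = Walk G x y d × (∀ m → Walk G x y m → d ≤ m)

StronglyResolves : (G : Graph) → V G → V G → V G → Set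
StronglyResolves G z x y =
    (∃[ a ] ∃[ b ] ∃[ c ] (Dist G y z a × Dist G y x b × Dist G x z c × a ≡ b + c))
  ⊎ (∃[ a ] ∃[ b ] ∃[ c ] (Dist G x z a × Dist G x y b × Dist G y z c × a ≡ b + c))

StrongResolvingSet : (G : Graph) → List (V G) → Set
StrongResolvingSet G S = ∀ x y → x ≢ y → Any (λ z → StronglyResolves G z x y) S

IsStrongMetricDim : (G : Graph) → ℕ → Set
IsStrongMetricDim G k =
    (Σ (List (V G)) λ S → Unique S × StrongResolvingSet G S × length S ≡ k)
  × (∀ (S : List (V G)) → Unique S → StrongResolvingSet G S → k ≤ length S)

{-# OPTIONS --safe #-}
module Submission where

-- Classify two positions of a cycle as the same, near (adjacent on the cycle) or far. Two cells of
-- C̄_s ◇ C̄_t are adjacent exactly when the pair (row kind, column kind) is one of (same, far),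
-- (far, same), (far, far), (near, near), and for s, t ≥ 5 any two non-adjacent cells have a common
-- neighbour. In a graph of diameter two a non-adjacent pair u, v is strongly resolved only by u or
-- v itself, so the complement of a strong resolving set is a clique; conversely the complement of
-- a clique K is strongly resolving when each u ∈ K has a neighbour outside N[v] for every other
-- v ∈ K. So dim_s = st − ω, and ω is attained by the cells with both coordinates even, or by the
-- diagonal when s = t = 5.
--
-- Bounding a clique K: cells of K in cycle-adjacent rows lie in cycle-adjacent columns, so the row
-- counts a(x) satisfy a(x) + a(x+1) ≤ 3 when both are positive, and a ≤ 1 if no row is empty.
-- Charging 3 for an isolated non-empty row and a(x) for any other row, such a cyclic sequence
-- weighs at most 3⌊s/2⌋: rotate it to start at an empty row and induct along the path. A cell lies
-- in an isolated row iff it lies in an isolated column, so with ρ and γ isolated rows and columns,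
-- |K| + 3ρ ≤ 3⌊s/2⌋ + ργ with ρ ≤ ⌊s/2⌋ and γ ≤ ⌊t/2⌋, which gives |K| ≤ ⌊s/2⌋⌊t/2⌋ as soon as
-- ⌊t/2⌋ ≥ 3. For s = t = 5 the estimate is too weak; instead a 5-colouring of the grid whose
-- colour classes are independent bounds cliques by 5.

open import Defs
open import Data.Bool using (Bool; true; false; T)
open import Data.Empty using (⊥; ⊥-elim)
open import Data.Fin using (Fin; zero; suc; toℕ; fromℕ; fromℕ<; inject₁; punchIn)
open import Data.Fin.Permutation using (Permutation′; permutation)
open import Data.Fin.Properties
  using (_≟_; any?; all?; toℕ-fromℕ<; fromℕ<-toℕ; toℕ-fromℕ; toℕ-inject₁; toℕ-injective; toℕ<n; punchInᵢ≢i)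
open import Data.List using (List; []; _∷_; length; filter; cartesianProduct; allFin)
open import Data.List.Membership.Propositional using (_∈_; _∉_; lose; find)
open import Data.List.Membership.Propositional.Properties
  using (∈-filter⁺; ∈-filter⁻; ∈-cartesianProduct⁺; ∈-allFin)
open import Data.List.Relation.Unary.All.Properties using (All¬⇒¬Any)
open import Data.List.Relation.Unary.AllPairs using (_∷_)
open import Data.List.Relation.Unary.Any using (here; there)
open import Data.List.Relation.Unary.Unique.Propositional using (Unique)
open import Data.List.Relation.Unary.Unique.Propositional.Properties using (filter⁺; cartesianProduct⁺; allFin⁺)
open import Data.Nat using (ℕ; zero; suc; _+_; _*_; _∸_; _⊔_; _≤_; _<_; z≤n; s≤s; _<?_; ⌊_/2⌋)
open import Data.Nat.DivMod using (_mod_)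
import Data.Nat.Properties as ℕ
open import Data.Product using (Σ; ∃; ∃₂; _×_; _,_; proj₁; proj₂; swap; curry; uncurry)
open import Data.Product.Properties using (≡-dec)
open import Data.Sum using (_⊎_; inj₁; inj₂)
open import Data.Unit using (⊤; tt)
open import Function using (_∘_; id; _⟨_⟩_)
open import Relation.Binary.Definitions using (DecidableEquality)
open import Relation.Binary.PropositionalEquality
open import Relation.Nullary using (¬_; Dec; yes; no)
open import Relation.Nullary.Decidable
  using (_×-dec_; _⊎-dec_; _→-dec_; ¬?; T?; decidable-stable; from-yes)
open import Algebra.Properties.Semiring.Sum ℕ.+-*-semiring
  using (sum; sum-cong-≗; sum-replicate-zero; sum-remove; sum-permute; ∑-distrib-+; ∑-comm;
         *-distribˡ-sum; *-distribʳ-sum)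

private variable
  k m n : ℕ

Succ : ℕ → ℕ → ℕ → Set
Succ n a b = b ≡ suc a ⊎ (b ≡ 0 × suc a ≡ n)

no-cycle₁ : ∀ {a} → ¬ Succ (2 + k) a a
no-cycle₁ (inj₁ ())
no-cycle₁ (inj₂ (refl , ()))

no-cycle₂ : ∀ {a b} → Succ (3 + k) a b → ¬ Succ (3 + k) b a
no-cycle₂ (inj₁ refl) (inj₁ ())
no-cycle₂ (inj₁ refl) (inj₂ (refl , ()))
no-cycle₂ (inj₂ (refl , refl)) (inj₁ ())
no-cycle₂ (inj₂ (refl , refl)) (inj₂ (() , _))

no-cycle₃ : ∀ {a b c} → Succ (4 + k) a b → Succ (4 + k) b c → ¬ Succ (4 + k) c a
no-cycle₃ (inj₁ refl) (inj₁ refl) (inj₁ ())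
no-cycle₃ (inj₁ refl) (inj₁ refl) (inj₂ (refl , ()))
no-cycle₃ (inj₁ refl) (inj₂ (refl , refl)) (inj₁ ())
no-cycle₃ (inj₁ refl) (inj₂ (refl , refl)) (inj₂ (() , _))
no-cycle₃ (inj₂ (refl , refl)) (inj₁ refl) (inj₁ ())
no-cycle₃ (inj₂ (refl , refl)) (inj₁ refl) (inj₂ (() , _))
no-cycle₃ (inj₂ (refl , refl)) (inj₂ (refl , ())) _

no-cycle₄ : ∀ {a b c d} → Succ (5 + k) a b → Succ (5 + k) b c → Succ (5 + k) c d → ¬ Succ (5 + k) d a
no-cycle₄ (inj₁ refl) (inj₁ refl) (inj₁ refl) (inj₁ ())
no-cycle₄ (inj₁ refl) (inj₁ refl) (inj₁ refl) (inj₂ (refl , ()))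
no-cycle₄ (inj₁ refl) (inj₁ refl) (inj₂ (refl , refl)) (inj₁ ())
no-cycle₄ (inj₁ refl) (inj₁ refl) (inj₂ (refl , refl)) (inj₂ (() , _))
no-cycle₄ (inj₁ refl) (inj₂ (refl , refl)) (inj₁ refl) (inj₁ ())
no-cycle₄ (inj₁ refl) (inj₂ (refl , refl)) (inj₁ refl) (inj₂ (() , _))
no-cycle₄ (inj₁ refl) (inj₂ (refl , refl)) (inj₂ (refl , ())) _
no-cycle₄ (inj₂ (refl , refl)) (inj₁ refl) (inj₁ refl) (inj₁ ())
no-cycle₄ (inj₂ (refl , refl)) (inj₁ refl) (inj₁ refl) (inj₂ (() , _))
no-cycle₄ (inj₂ (refl , refl)) (inj₁ refl) (inj₂ (refl , ())) _
no-cycle₄ (inj₂ (refl , refl)) (inj₂ (refl , ())) _ _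

Succ-injective : ∀ {a a' b} → Succ n a b → Succ n a' b → a ≡ a'
Succ-injective (inj₁ refl) (inj₁ q) = ℕ.suc-injective q
Succ-injective (inj₁ refl) (inj₂ (() , _))
Succ-injective (inj₂ (refl , _)) (inj₁ ())
Succ-injective (inj₂ (refl , p)) (inj₂ (_ , q)) = ℕ.suc-injective (trans p (sym q))

Succ-functional : ∀ {a b b'} → b < n → b' < n → Succ n a b → Succ n a b' → b ≡ b'
Succ-functional _ _ (inj₁ p) (inj₁ q) = trans p (sym q)
Succ-functional b<n _ (inj₁ refl) (inj₂ (_ , refl)) = ⊥-elim (ℕ.<-irrefl refl b<n)
Succ-functional _ b'<n (inj₂ (_ , refl)) (inj₁ refl) = ⊥-elim (ℕ.<-irrefl refl b'<n)
Succ-functional _ _ (inj₂ (p , _)) (inj₂ (q , _)) = trans p (sym q)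

Step : Fin n → Fin n → Set
Step {n} x y = Succ n (toℕ x) (toℕ y)

Step-injective : {x x' y : Fin n} → Step x y → Step x' y → x ≡ x'
Step-injective s s' = toℕ-injective (Succ-injective s s')

Step-functional : {x y y' : Fin n} → Step x y → Step x y' → y ≡ y'
Step-functional {y = y} {y'} s s' = toℕ-injective (Succ-functional (toℕ<n y) (toℕ<n y') s s')

CycAdj⇒Step : {x y : Fin n} → CycAdj n x y → Step x y ⊎ Step y x
CycAdj⇒Step (inj₁ p) = inj₁ (inj₁ p)
CycAdj⇒Step (inj₂ (inj₁ p)) = inj₂ (inj₁ p)
CycAdj⇒Step (inj₂ (inj₂ (inj₁ p))) = inj₂ (inj₂ p)
CycAdj⇒Step (inj₂ (inj₂ (inj₂ p))) = inj₁ (inj₂ p)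

Step⇒CycAdj : {x y : Fin n} → Step x y → CycAdj n x y
Step⇒CycAdj (inj₁ p) = inj₁ p
Step⇒CycAdj (inj₂ p) = inj₂ (inj₂ (inj₂ p))

Step⇒CycAdj˘ : {x y : Fin n} → Step y x → CycAdj n x y
Step⇒CycAdj˘ (inj₁ p) = inj₂ (inj₁ p)
Step⇒CycAdj˘ (inj₂ p) = inj₂ (inj₂ (inj₁ p))

CycAdj-sym : {x y : Fin n} → CycAdj n x y → CycAdj n y x
CycAdj-sym c with CycAdj⇒Step c
... | inj₁ s = Step⇒CycAdj˘ s
... | inj₂ s = Step⇒CycAdj s

CycAdj-irrefl : {x : Fin (2 + k)} → ¬ CycAdj (2 + k) x x
CycAdj-irrefl c with CycAdj⇒Step c
... | inj₁ s = no-cycle₁ s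
... | inj₂ s = no-cycle₁ s

next : Fin (suc m) → Fin (suc m)
next {m} x with suc (toℕ x) <? suc m
... | yes p = fromℕ< p
... | no _ = zero

prev : Fin (suc m) → Fin (suc m)
prev {m} zero = fromℕ m
prev (suc x) = inject₁ x

Step-next : (x : Fin (suc m)) → Step x (next x)
Step-next {m} x with suc (toℕ x) <? suc m
... | yes p = inj₁ (toℕ-fromℕ< p)
... | no ¬p = inj₂ (refl , ℕ.≤-antisym (toℕ<n x) (ℕ.≮⇒≥ ¬p))

Step-prev : (x : Fin (suc m)) → Step (prev x) x
Step-prev {m} zero = inj₂ (refl , cong suc (toℕ-fromℕ m))
Step-prev (suc x) = inj₁ (cong suc (sym (toℕ-inject₁ x)))

Step⇒next : {x y : Fin (suc m)} → Step x y → y ≡ next x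
Step⇒next {x = x} s = Step-functional s (Step-next x)

Step⇒prev : {x y : Fin (suc m)} → Step y x → y ≡ prev x
Step⇒prev {x = x} s = Step-injective s (Step-prev x)

next-prev : (x : Fin (suc m)) → next (prev x) ≡ x
next-prev x = sym (Step⇒next (Step-prev x))

prev-next : (x : Fin (suc m)) → prev (next x) ≡ x
prev-next x = sym (Step⇒prev (Step-next x))

next-inject₁ : (y : Fin m) → next (inject₁ y) ≡ suc y
next-inject₁ y = sym (Step⇒next (inj₁ (cong suc (sym (toℕ-inject₁ y)))))

CycAdj-next : (x : Fin (suc m)) → CycAdj _ x (next x)
CycAdj-next x = Step⇒CycAdj (Step-next x)

CycAdj-prev : (x : Fin (suc m)) → CycAdj _ x (prev x)
CycAdj-prev x = Step⇒CycAdj˘ (Step-prev x)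

CycAdj⇒next⊎prev : {x y : Fin (suc m)} → CycAdj (suc m) x y → y ≡ next x ⊎ y ≡ prev x
CycAdj⇒next⊎prev c with CycAdj⇒Step c
... | inj₁ s = inj₁ (Step⇒next s)
... | inj₂ s = inj₂ (Step⇒prev s)

CycAdj? : (x y : Fin n) → Dec (CycAdj n x y)
CycAdj? {n} x y = (toℕ y ℕ.≟ suc (toℕ x)) ⊎-dec (toℕ x ℕ.≟ suc (toℕ y))
  ⊎-dec ((toℕ x ℕ.≟ 0) ×-dec (suc (toℕ y) ℕ.≟ n)) ⊎-dec ((toℕ y ℕ.≟ 0) ×-dec (suc (toℕ x) ℕ.≟ n))

Far : Fin n → Fin n → Set
Far {n} = Adj (coCycle n)

Far? : (x y : Fin n) → Dec (Far x y)
Far? x y = ¬? (x ≟ y) ×-dec ¬? (CycAdj? x y)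

Far-sym : {x y : Fin n} → Far x y → Far y x
Far-sym (x≢y , ¬c) = (λ e → x≢y (sym e)) , (λ c → ¬c (CycAdj-sym c))

¬Far⇒CycAdj : {x y : Fin n} → x ≢ y → ¬ Far x y → CycAdj n x y
¬Far⇒CycAdj {x = x} {y} x≢y ¬far = decidable-stable (CycAdj? x y) (λ ¬c → ¬far (x≢y , ¬c))

common-neighbour-unique : {a a' b b' : Fin (5 + k)} → a ≢ a' →
  CycAdj _ a b → CycAdj _ a b' → CycAdj _ a' b → CycAdj _ a' b' → b ≡ b'
common-neighbour-unique a≢a' p q r s
  with CycAdj⇒Step p | CycAdj⇒Step q | CycAdj⇒Step r | CycAdj⇒Step s
... | inj₁ u | inj₁ v | _ | _ = Step-functional u v
... | inj₂ u | inj₂ v | _ | _ = Step-injective u v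
... | _ | _ | inj₁ u | inj₁ v = Step-functional u v
... | _ | _ | inj₂ u | inj₂ v = Step-injective u v
... | inj₁ u | inj₂ _ | inj₁ w | inj₂ _ = ⊥-elim (a≢a' (Step-injective u w))
... | inj₁ u | inj₂ v | inj₂ w | inj₁ z = ⊥-elim (no-cycle₄ u w z v)
... | inj₂ u | inj₁ v | inj₁ w | inj₂ z = ⊥-elim (no-cycle₄ v z w u)
... | inj₂ _ | inj₁ v | inj₂ _ | inj₁ z = ⊥-elim (a≢a' (Step-injective v z))

Step²⇒Far : {a b c : Fin (5 + k)} → Step a b → Step b c → Far a c
Step²⇒Far u v = (λ { refl → no-cycle₂ u v }) , not-adjacent
  where
  not-adjacent : ¬ CycAdj _ _ _
  not-adjacent w with CycAdj⇒Step w
  ... | inj₁ u' = no-cycle₁ (subst (λ q → Step q _) (Step-functional u u') v)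
  ... | inj₂ w' = no-cycle₃ u v w'

Step³⇒Far : {a b c d : Fin (5 + k)} → Step a b → Step b c → Step c d → Far a d
Step³⇒Far u v w = (λ { refl → no-cycle₃ u v w }) , not-adjacent
  where
  not-adjacent : ¬ CycAdj _ _ _
  not-adjacent z with CycAdj⇒Step z
  ... | inj₁ u' = no-cycle₂ (subst (λ q → Step q _) (Step-functional u u') v) w
  ... | inj₂ z' = no-cycle₄ u v w z'

far-from-edge : {h h' : Fin (5 + k)} → CycAdj _ h h' → ∃ λ z → Far h z × Far h' z
far-from-edge {h = h} {h'} c with CycAdj⇒Step c
... | inj₁ s = next (next h') , Step³⇒Far s s₁ s₂ , Step²⇒Far s₁ s₂
  where s₁ = Step-next h' ; s₂ = Step-next (next h')
... | inj₂ s = next (next h) , Step²⇒Far s₁ s₂ , Step³⇒Far s s₁ s₂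
  where s₁ = Step-next h ; s₂ = Step-next (next h)

far-neighbour : {h h' : Fin (5 + k)} → Far h h' → ∃ λ z → CycAdj _ h' z × Far h z
far-neighbour {h = h} {h'} (h≢h' , ¬c) with Far? h (next h') | Far? h (prev h')
... | yes far | _ = next h' , CycAdj-next h' , far
... | no _ | yes far = prev h' , CycAdj-prev h' , far
... | no ¬far₁ | no ¬far₂ = ⊥-elim (no-cycle₂ (Step-prev h') (subst (Step h') next≡prev (Step-next h')))
  where
  neighbour : ∀ {z} → CycAdj _ h' z → ¬ Far h z → CycAdj _ h z
  neighbour c ¬far = ¬Far⇒CycAdj (λ { refl → ¬c (CycAdj-sym c) }) ¬far
  next≡prev : next h' ≡ prev h'
  next≡prev = common-neighbour-unique h≢h'
    (neighbour (CycAdj-next h') ¬far₁) (neighbour (CycAdj-prev h') ¬far₂)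
    (CycAdj-next h') (CycAdj-prev h')

-- The modular product of two cycle complements

data Kind : Set where
  same near far : Kind

data KindOf {n} (x y : Fin n) : Kind → Set where
  same : x ≡ y → KindOf x y same
  near : CycAdj n x y → KindOf x y near
  far  : Far x y → KindOf x y far

kindOf : (x y : Fin n) → ∃ (KindOf x y)
kindOf x y with x ≟ y | CycAdj? x y
... | yes x≡y | _ = same , same x≡y
... | no _ | yes c = near , near c
... | no x≢y | no ¬c = far , far (x≢y , ¬c)

kindOf-unique : {x y : Fin (2 + k)} {κ κ' : Kind} → KindOf x y κ → KindOf x y κ' → κ ≡ κ'
kindOf-unique (same _) (same _) = refl
kindOf-unique (same refl) (near c) = ⊥-elim (CycAdj-irrefl c)
kindOf-unique (same x≡y) (far (x≢y , _)) = ⊥-elim (x≢y x≡y)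
kindOf-unique (near c) (same refl) = ⊥-elim (CycAdj-irrefl c)
kindOf-unique (near _) (near _) = refl
kindOf-unique (near c) (far (_ , ¬c)) = ⊥-elim (¬c c)
kindOf-unique (far (x≢y , _)) (same x≡y) = ⊥-elim (x≢y x≡y)
kindOf-unique (far (_ , ¬c)) (near c) = ⊥-elim (¬c c)
kindOf-unique (far _) (far _) = refl

KindOf-sym : {x y : Fin n} {κ : Kind} → KindOf x y κ → KindOf y x κ
KindOf-sym (same e) = same (sym e)
KindOf-sym (near c) = near (CycAdj-sym c)
KindOf-sym (far f) = far (Far-sym f)

-- The adjacency rule of the modular product, read with far = adjacent in C̄_n and
-- near = distinct but non-adjacent in C̄_n.
Compatible : Kind → Kind → Set
Compatible same far  = ⊤
Compatible far  same = ⊤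
Compatible far  far  = ⊤
Compatible near near = ⊤
Compatible _    _    = ⊥

compatible? : ∀ κ μ → Dec (Compatible κ μ)
compatible? same same = no λ ()
compatible? same near = no λ ()
compatible? same far  = yes tt
compatible? near same = no λ ()
compatible? near near = yes tt
compatible? near far  = no λ ()
compatible? far  same = yes tt
compatible? far  near = no λ ()
compatible? far  far  = yes tt

Compatible-sym : ∀ {κ μ} → Compatible κ μ → Compatible μ κ
Compatible-sym {same} {far}  _ = tt
Compatible-sym {far}  {same} _ = tt
Compatible-sym {far}  {far}  _ = tt
Compatible-sym {near} {near} _ = tt

Compatible-near-left : ∀ {κ} → Compatible near κ → κ ≡ near
Compatible-near-left {near} _ = refl

Compatible-near-right : ∀ {κ} → Compatible κ near → κ ≡ near
Compatible-near-right {near} _ = refl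

KindOf-near : ∀ {x y : Fin n} → KindOf x y near → CycAdj n x y
KindOf-near (near c) = c

module _ {k l : ℕ} where

  private
    G = coCycle (2 + k) ◇ coCycle (2 + l)

  Compatible⇒Adj : ∀ {g g' h h' κ μ} → KindOf g g' κ → KindOf h h' μ → Compatible κ μ → Adj G (g , h) (g' , h')
  Compatible⇒Adj (same e) (far f) _ = inj₁ (e , f)
  Compatible⇒Adj (far f) (same e) _ = inj₂ (inj₁ (f , e))
  Compatible⇒Adj (far f) (far f') _ = inj₂ (inj₂ (inj₁ (f , f')))
  Compatible⇒Adj (near c) (near c') _ = inj₂ (inj₂ (inj₂
    ( (λ { refl → CycAdj-irrefl c }) , (λ { refl → CycAdj-irrefl c' })
    , (λ f → proj₂ f c) , (λ f → proj₂ f c'))))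

  Adj⇒Compatible : ∀ {g g' h h' κ μ} → Adj G (g , h) (g' , h') → KindOf g g' κ → KindOf h h' μ → Compatible κ μ
  Adj⇒Compatible a kg kh with canonical a
    where
    canonical : ∀ {g g' h h'} → Adj G (g , h) (g' , h') → ∃₂ λ κ μ → KindOf g g' κ × KindOf h h' μ × Compatible κ μ
    canonical (inj₁ (e , f)) = same , far , same e , far f , tt
    canonical (inj₂ (inj₁ (f , e))) = far , same , far f , same e , tt
    canonical (inj₂ (inj₂ (inj₁ (f , f')))) = far , far , far f , far f' , tt
    canonical (inj₂ (inj₂ (inj₂ (g≢g' , h≢h' , ¬f , ¬f')))) =
      near , near , near (¬Far⇒CycAdj g≢g' ¬f) , near (¬Far⇒CycAdj h≢h' ¬f') , tt
  ... | κ , μ , kg' , kh' , comp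
    rewrite kindOf-unique kg kg' | kindOf-unique kh kh' = comp

  Adj? : (u v : Fin (2 + k) × Fin (2 + l)) → Dec (Adj G u v)
  Adj? (g , h) (g' , h') with kindOf g g' | kindOf h h'
  ... | κ , kg | μ , kh with compatible? κ μ
  ...   | yes comp = yes (Compatible⇒Adj kg kh comp)
  ...   | no ¬comp = no (λ a → ¬comp (Adj⇒Compatible a kg kh))

  Adj-sym : ∀ {u v} → Adj G u v → Adj G v u
  Adj-sym {g , h} {g' , h'} a =
    Compatible⇒Adj (KindOf-sym kg) (KindOf-sym kh) (Adj⇒Compatible a kg kh)
    where
    kg = proj₂ (kindOf g g')
    kh = proj₂ (kindOf h h')

  Adj-irrefl : ∀ {u} → ¬ Adj G u u
  Adj-irrefl a = Adj⇒Compatible a (same refl) (same refl)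

  Adj-near-rows : ∀ {g g' h h'} → Adj G (g , h) (g' , h') → CycAdj _ g g' → CycAdj _ h h'
  Adj-near-rows {h = h} {h'} a c with kindOf h h'
  ... | κ , kh with Compatible-near-left (Adj⇒Compatible a (near c) kh)
  ...   | refl = KindOf-near kh

  Adj-near-columns : ∀ {g g' h h'} → Adj G (g , h) (g' , h') → CycAdj _ h h' → CycAdj _ g g'
  Adj-near-columns {g = g} {g'} a c with kindOf g g'
  ... | κ , kg with Compatible-near-right (Adj⇒Compatible a kg (near c))
  ...   | refl = KindOf-near kg

  Adj-far-rows : ∀ {g g' h h'} → Adj G (g , h) (g' , h') → Far g g' → ¬ CycAdj _ h h'
  Adj-far-rows a f c = Adj⇒Compatible a (far f) (near c)

Adj-transpose : ∀ {k l g g' h h'} → Adj (coCycle (2 + k) ◇ coCycle (2 + l)) (g , h) (g' , h') →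
                Adj (coCycle (2 + l) ◇ coCycle (2 + k)) (h , g) (h' , g')
Adj-transpose {g = g} {g'} {h} {h'} a =
  Compatible⇒Adj kh kg (Compatible-sym (Adj⇒Compatible a kg kh))
  where
  kg = proj₂ (kindOf g g')
  kh = proj₂ (kindOf h h')

module _ {k l : ℕ} where

  private
    G = coCycle (5 + k) ◇ coCycle (5 + l)

  common-neighbour : ∀ {u v} → u ≢ v → ¬ Adj G u v → ∃ λ w → Adj G u w × Adj G w v
  common-neighbour {g , h} {g' , h'} u≢v ¬a with kindOf g g' | kindOf h h'
  ... | _ , same refl | _ , same refl = ⊥-elim (u≢v refl)
  ... | _ , same refl | _ , near c with far-from-edge c
  ...   | z , f , f' =
    (g , z) , Compatible⇒Adj (same refl) (far f) tt , Compatible⇒Adj (same refl) (far (Far-sym f')) tt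
  common-neighbour u≢v ¬a | _ , near c | _ , same refl with far-from-edge c
  ...   | z , f , f' =
    (z , _) , Compatible⇒Adj (far f) (same refl) tt , Compatible⇒Adj (far (Far-sym f')) (same refl) tt
  common-neighbour u≢v ¬a | _ , near c | _ , far f with far-neighbour f
  ...   | z , c' , f' =
    (_ , z) , Compatible⇒Adj (same refl) (far f') tt , Compatible⇒Adj (near c) (near (CycAdj-sym c')) tt
  common-neighbour u≢v ¬a | _ , far f | _ , near c with far-neighbour f
  ...   | z , c' , f' =
    (z , _) , Compatible⇒Adj (far f') (same refl) tt , Compatible⇒Adj (near (CycAdj-sym c')) (near c) tt
  common-neighbour u≢v ¬a | _ , same e | _ , far f = ⊥-elim (¬a (Compatible⇒Adj (same e) (far f) tt))
  common-neighbour u≢v ¬a | _ , near c | _ , near c' = ⊥-elim (¬a (Compatible⇒Adj (near c) (near c') tt))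
  common-neighbour u≢v ¬a | _ , far f | _ , same e = ⊥-elim (¬a (Compatible⇒Adj (far f) (same e) tt))
  common-neighbour u≢v ¬a | _ , far f | _ , far f' = ⊥-elim (¬a (Compatible⇒Adj (far f) (far f') tt))

-- Graphs of diameter two

IsClique : (G : Graph) → (V G → Set) → Set
IsClique G K = ∀ {u v} → K u → K v → u ≢ v → Adj G u v

module Diameter₂ (G : Graph)
  (_≟ᵥ_ : DecidableEquality (V G))
  (adj? : ∀ u v → Dec (Adj G u v))
  (adj-sym : ∀ {u v} → Adj G u v → Adj G v u)
  (adj-irrefl : ∀ {u} → ¬ Adj G u u)
  (common-neighbour : ∀ {u v} → u ≢ v → ¬ Adj G u v → ∃ λ w → Adj G u w × Adj G w v)
  where

  walk-0 : ∀ {x y} → Walk G x y 0 → x ≡ y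
  walk-0 nil = refl

  walk-≥2 : ∀ {x y m} → Walk G x y m → x ≢ y → ¬ Adj G x y → 2 ≤ m
  walk-≥2 {m = 0} w x≢y _ = ⊥-elim (x≢y (walk-0 w))
  walk-≥2 {m = 1} (cons a w) _ ¬a = ⊥-elim (¬a (subst (Adj G _) (walk-0 w) a))
  walk-≥2 {m = suc (suc _)} _ _ _ = s≤s (s≤s z≤n)

  Dist-0 : ∀ {u} → Dist G u u 0
  Dist-0 = nil , λ _ _ → z≤n

  Dist-1 : ∀ {u v} → Adj G u v → Dist G u v 1
  Dist-1 a = cons a nil , λ { zero w → ⊥-elim (adj-irrefl (subst (Adj G _) (sym (walk-0 w)) a))
                            ; (suc m) w → s≤s z≤n }

  Dist-2 : ∀ {u v w} → u ≢ v → ¬ Adj G u v → Adj G u w → Adj G w v → Dist G u v 2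
  Dist-2 u≢v ¬a a b = cons a (cons b nil) , λ _ w → walk-≥2 w u≢v ¬a

  dist : ∀ u v → ∃ λ d → Dist G u v d × d ≤ 2
  dist u v with u ≟ᵥ v
  ... | yes refl = 0 , Dist-0 , z≤n
  ... | no u≢v with adj? u v
  ...   | yes a = 1 , Dist-1 a , s≤s z≤n
  ...   | no ¬a with common-neighbour u≢v ¬a
  ...     | w , a , b = 2 , Dist-2 u≢v ¬a a b , ℕ.≤-refl

  Dist-≤2 : ∀ {u v d} → Dist G u v d → d ≤ 2
  Dist-≤2 {u} {v} (_ , minimal) with dist u v
  ... | d , (w , _) , d≤2 = ℕ.≤-trans (minimal d w) d≤2

  private
    excess-0 : ∀ {a b c} → 2 ≤ b → a ≤ 2 → a ≡ b + c → c ≡ 0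
    excess-0 {c = c} 2≤b a≤2 refl = ℕ.n≤0⇒n≡0 (ℕ.+-cancelˡ-≤ 2 c 0 (ℕ.≤-trans (ℕ.+-monoˡ-≤ c 2≤b) a≤2))

  resolves-nonadjacent : ∀ {x y z} → x ≢ y → ¬ Adj G x y → StronglyResolves G z x y → z ≡ x ⊎ z ≡ y
  resolves-nonadjacent x≢y ¬a (inj₁ (_ , b , c , dyz , (wyx , _) , (wxz , _) , a≡b+c)) =
    inj₁ (sym (walk-0 (subst (Walk G _ _)
      (excess-0 (walk-≥2 wyx (x≢y ∘ sym) (¬a ∘ adj-sym)) (Dist-≤2 dyz) a≡b+c) wxz)))
  resolves-nonadjacent x≢y ¬a (inj₂ (_ , b , c , dxz , (wxy , _) , (wyz , _) , a≡b+c)) =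
    inj₂ (sym (walk-0 (subst (Walk G _ _)
      (excess-0 (walk-≥2 wxy x≢y ¬a) (Dist-≤2 dxz) a≡b+c) wyz)))

  complement-is-clique : ∀ {S} → StrongResolvingSet G S → IsClique G (_∉ S)
  complement-is-clique {S} resolving {u} {v} u∉S v∉S u≢v with adj? u v
  ... | yes a = a
  ... | no ¬a with find (resolving u v u≢v)
  ...   | z , z∈S , r with resolves-nonadjacent u≢v ¬a r
  ...     | inj₁ refl = ⊥-elim (u∉S z∈S)
  ...     | inj₂ refl = ⊥-elim (v∉S z∈S)

  HasNeighbourOutside : V G → V G → Set
  HasNeighbourOutside u v = ∃ λ z → Adj G u z × z ≢ v × ¬ Adj G v z

  module _ (vertices : List (V G)) (∈-vertices : ∀ v → v ∈ vertices)
           {K : V G → Set} (K? : ∀ v → Dec (K v))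
           (clique : IsClique G K)
           (outside : ∀ {u v} → K u → K v → u ≢ v → HasNeighbourOutside u v) where

    complement-resolving : StrongResolvingSet G (filter (¬? ∘ K?) vertices)
    complement-resolving u v u≢v with K? u | K? v
    ... | no ¬Ku | _ = lose (∈-filter⁺ (¬? ∘ K?) (∈-vertices u) ¬Ku)
                          (inj₁ (d , d , 0 , dvu , dvu , Dist-0 , sym (ℕ.+-identityʳ d)))
      where d = proj₁ (dist v u) ; dvu = proj₁ (proj₂ (dist v u))
    ... | yes _ | no ¬Kv = lose (∈-filter⁺ (¬? ∘ K?) (∈-vertices v) ¬Kv)
                          (inj₂ (d , d , 0 , duv , duv , Dist-0 , sym (ℕ.+-identityʳ d)))
      where d = proj₁ (dist u v) ; duv = proj₁ (proj₂ (dist u v))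
    ... | yes Ku | yes Kv with outside Ku Kv u≢v
    ...   | z , a , z≢v , ¬b = lose (∈-filter⁺ (¬? ∘ K?) (∈-vertices z) ¬Kz)
        (inj₁ (2 , 1 , 1 , Dist-2 (z≢v ∘ sym) ¬b (adj-sym uv) a , Dist-1 (adj-sym uv) , Dist-1 a , refl))
      where
      uv = clique Ku Kv u≢v
      ¬Kz : ¬ K z
      ¬Kz Kz = ¬b (clique Kv Kz (z≢v ∘ sym))

sum-mono-≤ : {f g : Fin n → ℕ} → (∀ i → f i ≤ g i) → sum f ≤ sum g
sum-mono-≤ {zero} _ = z≤n
sum-mono-≤ {suc n} f≤g = ℕ.+-mono-≤ (f≤g zero) (sum-mono-≤ (f≤g ∘ suc))

sum-const : ∀ n c → sum {n} (λ _ → c) ≡ n * c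
sum-const zero c = refl
sum-const (suc n) c = cong (c +_) (sum-const n c)

χ : ∀ {P : Set} → Dec P → ℕ
χ (yes _) = 1
χ (no _) = 0

χ-mono : ∀ {P Q : Set} → (P → Q) → (p : Dec P) (q : Dec Q) → χ p ≤ χ q
χ-mono _ (no _) _ = z≤n
χ-mono f (yes p) (yes _) = ℕ.≤-refl
χ-mono f (yes p) (no ¬q) = ⊥-elim (¬q (f p))

χ-cong : ∀ {P Q : Set} → (P → Q) → (Q → P) → (p : Dec P) (q : Dec Q) → χ p ≡ χ q
χ-cong f g p q = ℕ.≤-antisym (χ-mono f p q) (χ-mono g q p)

χ-× : ∀ {P Q : Set} (p : Dec P) (q : Dec Q) → χ (p ×-dec q) ≡ χ p * χ q
χ-× (yes _) (yes _) = refl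
χ-× (yes _) (no _) = refl
χ-× (no _) _ = refl

χ-yes : ∀ {P : Set} → P → (p : Dec P) → χ p ≡ 1
χ-yes _ (yes _) = refl
χ-yes p (no ¬p) = ⊥-elim (¬p p)

χ-no : ∀ {P : Set} → ¬ P → (p : Dec P) → χ p ≡ 0
χ-no ¬p (yes p) = ⊥-elim (¬p p)
χ-no _ (no _) = refl

χ-¬ : ∀ {P : Set} (p : Dec P) → χ p + χ (¬? p) ≡ 1
χ-¬ (yes _) = refl
χ-¬ (no _) = refl

module _ {n : ℕ} where

  count : {P : Fin n → Set} → (∀ i → Dec (P i)) → ℕ
  count P? = sum (χ ∘ P?)

  count-mono : {P Q : Fin n → Set} → (∀ {i} → P i → Q i) →
               (P? : ∀ i → Dec (P i)) (Q? : ∀ i → Dec (Q i)) → count P? ≤ count Q?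
  count-mono P⊆Q P? Q? = sum-mono-≤ (λ i → χ-mono P⊆Q (P? i) (Q? i))

  count-cong : {P Q : Fin n → Set} → (∀ {i} → P i → Q i) → (∀ {i} → Q i → P i) →
               (P? : ∀ i → Dec (P i)) (Q? : ∀ i → Dec (Q i)) → count P? ≡ count Q?
  count-cong P⊆Q Q⊆P P? Q? = ℕ.≤-antisym (count-mono P⊆Q P? Q?) (count-mono Q⊆P Q? P?)

  count-∅ : {P : Fin n → Set} → (∀ i → ¬ P i) → (P? : ∀ i → Dec (P i)) → count P? ≡ 0
  count-∅ ¬P P? = ℕ.n≤0⇒n≡0 (ℕ.≤-trans (count-mono (λ {i} p → ¬P i p) P? (λ _ → no id))
                                       (ℕ.≤-reflexive (sum-replicate-zero n)))

  count-complement : {P : Fin n → Set} (P? : ∀ i → Dec (P i)) → count P? + count (¬? ∘ P?) ≡ n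
  count-complement P? = begin
    count P? + count (¬? ∘ P?)           ≡⟨ ∑-distrib-+ (χ ∘ P?) (χ ∘ ¬? ∘ P?) ⟨
    sum (λ i → χ (P? i) + χ (¬? (P? i))) ≡⟨ sum-cong-≗ (χ-¬ ∘ P?) ⟩
    sum {n} (λ _ → 1)                    ≡⟨ sum-const n 1 ⟩
    n * 1                                ≡⟨ ℕ.*-identityʳ n ⟩
    n                                    ∎
    where open ≡-Reasoning

  count-⊎ : {P Q R : Fin n → Set} → (∀ {i} → P i → Q i ⊎ R i) →
            (P? : ∀ i → Dec (P i)) (Q? : ∀ i → Dec (Q i)) (R? : ∀ i → Dec (R i)) →
            count P? ≤ count Q? + count R?
  count-⊎ {P} {Q} {R} P⊆Q∪R P? Q? R? = ℕ.≤-trans (sum-mono-≤ (λ i → χ-⊎ (P? i) (Q? i) (R? i)))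
                                     (ℕ.≤-reflexive (∑-distrib-+ (χ ∘ Q?) (χ ∘ R?)))
    where
    χ-⊎ : ∀ {i} (p : Dec (P i)) (q : Dec (Q i)) (r : Dec (R i)) → χ p ≤ χ q + χ r
    χ-⊎ (no _) _ _ = z≤n
    χ-⊎ (yes p) q r with P⊆Q∪R p
    ... | inj₁ qi = ℕ.≤-trans (χ-mono (λ _ → qi) (yes p) q) (ℕ.m≤m+n (χ q) (χ r))
    ... | inj₂ ri = ℕ.≤-trans (χ-mono (λ _ → ri) (yes p) r) (ℕ.m≤n+m (χ r) (χ q))

  count>0⇒∃ : {P : Fin n → Set} (P? : ∀ i → Dec (P i)) → 0 < count P? → ∃ P
  count>0⇒∃ P? count>0 with any? P?
  ... | yes ∃P = ∃P
  ... | no ¬∃P = ⊥-elim (ℕ.<-irrefl (sym (count-∅ (λ i p → ¬∃P (i , p)) P?)) count>0)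

count-≡ : ∀ {n} (x : Fin n) → count (_≟ x) ≡ 1
count-≡ {suc n} x = begin
  count (_≟ x)                                  ≡⟨ sum-remove {i = x} (χ ∘ (_≟ x)) ⟩
  χ (x ≟ x) + sum (λ j → χ (punchIn x j ≟ x))   ≡⟨ cong₂ _+_ (χ-yes refl (x ≟ x))
                                                            (count-∅ (punchInᵢ≢i x) (λ j → punchIn x j ≟ x)) ⟩
  1                                             ∎
  where open ≡-Reasoning

count-≡˘ : ∀ {n} (x : Fin n) → count (x ≟_) ≡ 1
count-≡˘ {n} x = trans (count-cong {n} sym sym (x ≟_) (_≟ x)) (count-≡ x)

module _ {n : ℕ} {P : Fin n → Set} (P? : ∀ i → Dec (P i)) where

  ∃⇒count>0 : ∀ {i} → P i → 0 < count P?
  ∃⇒count>0 {i} p = ℕ.≤-trans (ℕ.≤-reflexive (sym (count-≡ i))) (count-mono (λ { refl → p }) (_≟ i) P?)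

  count-≤1 : (∀ {i j} → P i → P j → i ≡ j) → count P? ≤ 1
  count-≤1 unique with any? P?
  ... | yes (i , p) = ℕ.≤-trans (count-mono (λ q → unique q p) P? (_≟ i)) (ℕ.≤-reflexive (count-≡ i))
  ... | no ¬∃P = ℕ.≤-trans (ℕ.≤-reflexive (count-∅ (λ i p → ¬∃P (i , p)) P?)) z≤n

  count≥2⇒distinct : 2 ≤ count P? → ∃₂ λ i j → P i × P j × i ≢ j
  count≥2⇒distinct 2≤count with any? (λ i → any? (λ j → P? i ×-dec P? j ×-dec ¬? (i ≟ j)))
  ... | yes (i , j , p , q , i≢j) = i , j , p , q , i≢j
  ... | no ¬distinct = ⊥-elim (ℕ.<-irrefl refl (ℕ.≤-trans 2≤count (count-≤1 unique)))
    where
    unique : ∀ {i j} → P i → P j → i ≡ j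
    unique {i} {j} p q = decidable-stable (i ≟ j) (λ i≢j → ¬distinct (i , j , p , q , i≢j))

module _ {m n : ℕ} where

  private
    Cell = Fin m × Fin n

  _≟₂_ : DecidableEquality Cell
  _≟₂_ = ≡-dec _≟_ _≟_

  ∑₂ : (Cell → ℕ) → ℕ
  ∑₂ f = sum (λ x → sum (λ y → f (x , y)))

  ∑₂-distrib-+ : (f g : Cell → ℕ) → ∑₂ (λ v → f v + g v) ≡ ∑₂ f + ∑₂ g
  ∑₂-distrib-+ f g = trans (sum-cong-≗ (λ x → ∑-distrib-+ (λ y → f (x , y)) (λ y → g (x , y))))
                           (∑-distrib-+ (λ x → sum (λ y → f (x , y))) (λ x → sum (λ y → g (x , y))))

  count₂ : {P : Cell → Set} → (∀ v → Dec (P v)) → ℕ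
  count₂ P? = sum (λ x → count (curry P? x))

  count₂-complement : {P : Cell → Set} (P? : ∀ v → Dec (P v)) → count₂ P? + count₂ (¬? ∘ P?) ≡ m * n
  count₂-complement P? = begin
    count₂ P? + count₂ (¬? ∘ P?)
      ≡⟨ ∑-distrib-+ (count ∘ curry P?) (λ x → count (¬? ∘ curry P? x)) ⟨
    sum (λ x → count (curry P? x) + count (¬? ∘ curry P? x)) ≡⟨ sum-cong-≗ (count-complement ∘ curry P?) ⟩
    sum {m} (λ _ → n)                                        ≡⟨ sum-const m n ⟩
    m * n                                                    ∎
    where open ≡-Reasoning

  count₂-≡ : (u : Cell) → count₂ (_≟₂ u) ≡ 1
  count₂-≡ (g , h) = trans (sum-cong-≗ row) (count-≡ g)
    where
    row : ∀ x → count (λ y → (x , y) ≟₂ (g , h)) ≡ χ (x ≟ g)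
    row x = by-cases (x ≟ g)
      where
      by-cases : (d : Dec (x ≡ g)) → count (λ y → (x , y) ≟₂ (g , h)) ≡ χ d
      by-cases (yes refl) =
        trans (count-cong (cong proj₂) (cong (x ,_)) (λ y → (x , y) ≟₂ (g , h)) (_≟ h)) (count-≡ h)
      by-cases (no x≢g) = count-∅ (λ y e → x≢g (cong proj₁ e)) (λ y → (x , y) ≟₂ (g , h))

  count₂-mono : {P Q : Cell → Set} → (∀ {v} → P v → Q v) → (P? : ∀ v → Dec (P v)) (Q? : ∀ v → Dec (Q v)) →
                count₂ P? ≤ count₂ Q?
  count₂-mono P⊆Q P? Q? = sum-mono-≤ (λ x → count-mono P⊆Q (curry P? x) (curry Q? x))

  count₂-cong : {P Q : Cell → Set} → (∀ {v} → P v → Q v) → (∀ {v} → Q v → P v) →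
                (P? : ∀ v → Dec (P v)) (Q? : ∀ v → Dec (Q v)) → count₂ P? ≡ count₂ Q?
  count₂-cong P⊆Q Q⊆P P? Q? = sum-cong-≗ (λ x → count-cong P⊆Q Q⊆P (curry P? x) (curry Q? x))

  count₂-× : {P : Fin m → Set} {Q : Fin n → Set} (P? : ∀ x → Dec (P x)) (Q? : ∀ y → Dec (Q y)) →
             count₂ (λ v → P? (proj₁ v) ×-dec Q? (proj₂ v)) ≡ count P? * count Q?
  count₂-× P? Q? = begin
    sum (λ x → sum (λ y → χ (P? x ×-dec Q? y)))   ≡⟨ sum-cong-≗ (λ x → sum-cong-≗ (λ y → χ-× (P? x) (Q? y))) ⟩
    sum (λ x → sum (λ y → χ (P? x) * χ (Q? y)))   ≡⟨ sum-cong-≗ (λ x → *-distribˡ-sum (χ (P? x)) (χ ∘ Q?)) ⟨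
    sum (λ x → χ (P? x) * count Q?)               ≡⟨ *-distribʳ-sum (count Q?) (χ ∘ P?) ⟨
    count P? * count Q?                           ∎
    where open ≡-Reasoning

  count₂-≤1 : {P : Cell → Set} (P? : ∀ v → Dec (P v)) → (∀ {u v} → P u → P v → u ≡ v) → count₂ P? ≤ 1
  count₂-≤1 P? unique with any? (any? ∘ curry P?)
  ... | yes (x , y , p) =
    ℕ.≤-trans (count₂-mono (λ q → unique q p) P? (_≟₂ (x , y))) (ℕ.≤-reflexive (count₂-≡ (x , y)))
  ... | no ¬∃P = ℕ.≤-reflexive (trans (sum-cong-≗ (λ x → count-∅ (λ y p → ¬∃P (x , y , p)) (curry P? x)))
                                     (sum-replicate-zero m)) ⟨ ℕ.≤-trans ⟩ z≤n

  ∑₂-comm : ∀ {r} (F : Cell → Fin r → ℕ) → ∑₂ (λ v → sum (F v)) ≡ sum (λ c → ∑₂ (λ v → F v c))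
  ∑₂-comm F = trans (sum-cong-≗ (λ x → ∑-comm (λ y c → F (x , y) c))) (∑-comm (λ x c → sum (λ y → F (x , y) c)))

  open import Data.List.Membership.DecPropositional _≟₂_ using (_∈?_)

  count₂-∈ : (S : List Cell) → Unique S → count₂ (_∈? S) ≡ length S
  count₂-∈ [] _ = trans (sum-cong-≗ (λ x → count-∅ (λ y ()) (λ y → (x , y) ∈? []))) (sum-replicate-zero m)
  count₂-∈ (z ∷ S) (z∉S ∷ unique) = begin
    count₂ (_∈? (z ∷ S))                       ≡⟨ sum-cong-≗ (λ x → sum-cong-≗ (λ y → split (x , y) ((x , y) ≟₂ z))) ⟩
    ∑₂ (λ v → χ (v ≟₂ z) + χ (v ∈? S))         ≡⟨ ∑₂-distrib-+ (λ v → χ (v ≟₂ z)) (λ v → χ (v ∈? S)) ⟩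
    count₂ (_≟₂ z) + count₂ (_∈? S)            ≡⟨ cong₂ _+_ (count₂-≡ z) (count₂-∈ S unique) ⟩
    suc (length S)                             ∎
    where
    open ≡-Reasoning
    split : ∀ v → (d : Dec (v ≡ z)) → χ (v ∈? (z ∷ S)) ≡ χ d + χ (v ∈? S)
    split v (yes refl) = trans (χ-yes (here refl) (v ∈? (z ∷ S))) (cong suc (sym (χ-no (All¬⇒¬Any z∉S) (v ∈? S))))
    split v (no v≢z) = χ-cong (λ { (here e) → ⊥-elim (v≢z e) ; (there v∈S) → v∈S }) there (v ∈? (z ∷ S)) (v ∈? S)

  count₂-≤-colouring : ∀ {r} {P : Cell → Set} (P? : ∀ v → Dec (P v)) (colour : Cell → Fin r) →
                       (∀ {u v} → P u → P v → colour u ≡ colour v → u ≡ v) → count₂ P? ≤ r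
  count₂-≤-colouring {r} P? colour injective = begin
    count₂ P?                                              ≡⟨ sum-cong-≗ (λ x → sum-cong-≗ (λ y → classes (x , y))) ⟨
    ∑₂ (λ v → sum (λ c → χ (P? v ×-dec (colour v ≟ c))))    ≡⟨ ∑₂-comm (λ v c → χ (P? v ×-dec (colour v ≟ c))) ⟩
    sum (λ c → count₂ (λ v → P? v ×-dec (colour v ≟ c)))
      ≤⟨ sum-mono-≤ (λ c → count₂-≤1 (λ v → P? v ×-dec (colour v ≟ c))
                                    (λ { (p , refl) (q , e) → injective p q (sym e) })) ⟩
    sum {r} (λ _ → 1)                                      ≡⟨ trans (sum-const r 1) (ℕ.*-identityʳ r) ⟩
    r                                                      ∎
    where
    open ℕ.≤-Reasoning
    classes : ∀ v → sum (λ c → χ (P? v ×-dec (colour v ≟ c))) ≡ χ (P? v)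
    classes v = ≡.begin
      sum (λ c → χ (P? v ×-dec (colour v ≟ c)))  ≡.≡⟨ sum-cong-≗ (λ c → χ-× (P? v) (colour v ≟ c)) ⟩
      sum (λ c → χ (P? v) * χ (colour v ≟ c))    ≡.≡⟨ *-distribˡ-sum (χ (P? v)) (λ c → χ (colour v ≟ c)) ⟨
      χ (P? v) * count (colour v ≟_)             ≡.≡⟨ cong (χ (P? v) *_) (count-≡˘ (colour v)) ⟩
      χ (P? v) * 1                               ≡.≡⟨ ℕ.*-identityʳ (χ (P? v)) ⟩
      χ (P? v)                                   ≡.∎
      where module ≡ = ≡-Reasoning

neighbours-≤2 : {P : Fin (suc m) → Set} (P? : ∀ y → Dec (P y)) (c : Fin (suc m)) →
                (∀ {y} → P y → CycAdj _ c y) → count P? ≤ 2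
neighbours-≤2 P? c neighbour =
  ℕ.≤-trans (count-⊎ (CycAdj⇒next⊎prev ∘ neighbour) P? (_≟ next c) (_≟ prev c))
            (ℕ.≤-reflexive (cong₂ _+_ (count-≡ (next c)) (count-≡ (prev c))))

-- Weights of cyclic sequences

weight : ℕ → ℕ → ℕ → ℕ
weight _       zero    _       = 0
weight zero    (suc c) zero    = 3
weight zero    (suc c) (suc _) = suc c
weight (suc _) (suc c) _       = suc c

isolated : ℕ → ℕ → ℕ → ℕ
isolated _       zero    _       = 0
isolated zero    (suc _) zero    = 1
isolated zero    (suc _) (suc _) = 0
isolated (suc _) (suc _) _       = 0

weight-+-isolated : ∀ l c r → weight l c r + c * isolated l c r ≡ c + 3 * isolated l c r
weight-+-isolated l zero r = refl
weight-+-isolated zero (suc c) zero = cong suc (trans (cong (3 +_) (ℕ.*-identityʳ c)) (ℕ.+-comm 3 c))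
weight-+-isolated zero (suc c) (suc r) = cong (λ x → suc (c + x)) (ℕ.*-zeroʳ c)
weight-+-isolated (suc l) (suc c) r = cong (λ x → suc (c + x)) (ℕ.*-zeroʳ c)

isolated-≤1 : ∀ l c r → isolated l c r ≤ 1
isolated-≤1 _ zero _ = z≤n
isolated-≤1 zero (suc _) zero = ℕ.≤-refl
isolated-≤1 zero (suc _) (suc _) = z≤n
isolated-≤1 (suc _) (suc _) _ = z≤n

3*isolated≤weight : ∀ l c r → 3 * isolated l c r ≤ weight l c r
3*isolated≤weight _ zero _ = z≤n
3*isolated≤weight zero (suc _) zero = ℕ.≤-refl
3*isolated≤weight zero (suc _) (suc _) = z≤n
3*isolated≤weight (suc _) (suc _) _ = z≤n

isolated-positive : ∀ l c r → 0 < c → isolated l c r ≡ χ ((l ℕ.≟ 0) ×-dec (r ℕ.≟ 0))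
isolated-positive zero (suc c) zero _ = refl
isolated-positive zero (suc c) (suc r) _ = refl
isolated-positive (suc l) (suc c) r _ = refl

weight-right-pos : ∀ l c r → weight l c (suc r) ≡ c
weight-right-pos l zero r = refl
weight-right-pos zero (suc c) r = refl
weight-right-pos (suc l) (suc c) r = refl

weight-≤3 : ∀ l c → (0 < l → 0 < c → l + c ≤ 3) → weight l c 0 ≤ 3
weight-≤3 l zero _ = z≤n
weight-≤3 zero (suc c) _ = ℕ.≤-refl
weight-≤3 (suc l) (suc c) sparse = ℕ.≤-trans (ℕ.m≤n+m (suc c) (suc l)) (sparse (s≤s z≤n) (s≤s z≤n))

Sparse : {A : Set} → (A → A) → (A → ℕ) → Set
Sparse step a = ∀ x → 0 < a x → 0 < a (step x) → a x + a (step x) ≤ 3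

-- Weights of the positions 1, …, m; b 0 and b (1 + m) only serve as neighbours.
pathWeight : ℕ → (ℕ → ℕ) → ℕ
pathWeight m b = sum {m} (λ i → weight (b (toℕ i)) (b (1 + toℕ i)) (b (2 + toℕ i)))

pathWeight-≤ : ∀ m b → b (suc m) ≡ 0 → Sparse (1 +_) b → pathWeight m b ≤ 3 * ⌊ suc m /2⌋
pathWeight-≤ zero b _ _ = z≤n
pathWeight-≤ (suc zero) b b₂≡0 sparse rewrite b₂≡0 =
  ℕ.≤-trans (ℕ.≤-reflexive (ℕ.+-identityʳ _)) (weight-≤3 (b 0) (b 1) (sparse 0))
pathWeight-≤ (suc (suc m)) b b≡0 sparse =
  two-steps (b 0) (b 1) (b 2) (b 3)
    (pathWeight-≤ m (λ i → b (2 + i)) b≡0 (λ i → sparse (2 + i)))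
    (ℕ.≤-trans (pathWeight-≤ (suc m) (λ i → b (1 + i)) b≡0 (λ i → sparse (1 + i)))
               (ℕ.*-monoʳ-≤ 3 (ℕ.⌊n/2⌋-mono (ℕ.n≤1+n (suc (suc m))))))
    (sparse 0) (sparse 1)
  where
  Q = ⌊ suc m /2⌋
  X = pathWeight m (λ i → b (2 + i))
  two-steps : ∀ b₀ b₁ b₂ b₃ → X ≤ 3 * Q → weight b₁ b₂ b₃ + X ≤ 3 * suc Q →
              (0 < b₀ → 0 < b₁ → b₀ + b₁ ≤ 3) → (0 < b₁ → 0 < b₂ → b₁ + b₂ ≤ 3) →
              weight b₀ b₁ b₂ + (weight b₁ b₂ b₃ + X) ≤ 3 * suc Q
  two-steps b₀ zero b₂ b₃ _ rest _ _ = rest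
  two-steps b₀ (suc b₁) zero b₃ X≤ _ sparse₀ _ =
    ℕ.≤-trans (ℕ.+-mono-≤ (weight-≤3 b₀ (suc b₁) sparse₀) X≤) (ℕ.≤-reflexive (sym (ℕ.*-suc 3 Q)))
  two-steps b₀ (suc b₁) (suc b₂) b₃ X≤ _ _ sparse₁ = begin
    weight b₀ (suc b₁) (suc b₂) + (suc b₂ + X) ≡⟨ cong (_+ (suc b₂ + X)) (weight-right-pos b₀ (suc b₁) b₂) ⟩
    suc b₁ + (suc b₂ + X)                      ≡⟨ ℕ.+-assoc (suc b₁) (suc b₂) X ⟨
    (suc b₁ + suc b₂) + X                      ≤⟨ ℕ.+-mono-≤ (sparse₁ (s≤s z≤n) (s≤s z≤n)) X≤ ⟩
    3 + 3 * Q                                  ≡⟨ ℕ.*-suc 3 Q ⟨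
    3 * suc Q                                  ∎
    where open ℕ.≤-Reasoning

weightAt : (Fin (suc m) → ℕ) → Fin (suc m) → ℕ
weightAt a x = weight (a (prev x)) (a x) (a (next x))

isolatedAt : (Fin (suc m) → ℕ) → Fin (suc m) → ℕ
isolatedAt a x = isolated (a (prev x)) (a x) (a (next x))

cycleWeight : (Fin (suc m) → ℕ) → ℕ
cycleWeight a = sum (weightAt a)

cycleWeight-+-isolated : (a : Fin (suc m) → ℕ) →
                         cycleWeight a + sum (λ x → a x * isolatedAt a x) ≡ sum a + 3 * sum (isolatedAt a)
cycleWeight-+-isolated a = begin
  cycleWeight a + sum (λ x → a x * isolatedAt a x)   ≡⟨ ∑-distrib-+ (weightAt a) (λ x → a x * isolatedAt a x) ⟨
  sum (λ x → weightAt a x + a x * isolatedAt a x)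
    ≡⟨ sum-cong-≗ (λ x → weight-+-isolated (a (prev x)) (a x) (a (next x))) ⟩
  sum (λ x → a x + 3 * isolatedAt a x)               ≡⟨ ∑-distrib-+ a (λ x → 3 * isolatedAt a x) ⟩
  sum a + sum (λ x → 3 * isolatedAt a x)             ≡⟨ cong (sum a +_) (*-distribˡ-sum 3 (isolatedAt a)) ⟨
  sum a + 3 * sum (isolatedAt a)                     ∎
  where open ≡-Reasoning

3*isolated≤cycleWeight : (a : Fin (suc m) → ℕ) → 3 * sum (isolatedAt a) ≤ cycleWeight a
3*isolated≤cycleWeight a = ℕ.≤-trans (ℕ.≤-reflexive (*-distribˡ-sum 3 (isolatedAt a)))
  (sum-mono-≤ (λ x → 3*isolated≤weight (a (prev x)) (a x) (a (next x))))

next-permutation : Permutation′ (suc m)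
next-permutation = permutation next prev next-prev prev-next

cycleWeight-rotate : (a : Fin (suc m) → ℕ) → cycleWeight (a ∘ next) ≡ cycleWeight a
cycleWeight-rotate a = begin
  sum (λ x → weight (a (next (prev x))) (a (next x)) (a (next (next x))))
    ≡⟨ sum-cong-≗ (λ x → cong (λ y → weight (a y) (a (next x)) (a (next (next x)))) (next-prev x)) ⟩
  sum (λ x → weight (a x) (a (next x)) (a (next (next x))))
    ≡⟨ sum-cong-≗ (λ x → cong (λ y → weight (a y) (a (next x)) (a (next (next x)))) (prev-next x)) ⟨
  sum (λ x → weight (a (prev (next x))) (a (next x)) (a (next (next x))))
    ≡⟨ sum-permute (λ x → weight (a (prev x)) (a x) (a (next x))) next-permutation ⟨
  cycleWeight a
    ∎
  where open ≡-Reasoning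

extend : (Fin n → ℕ) → ℕ → ℕ
extend {n} a j with j <? n
... | yes j<n = a (fromℕ< j<n)
... | no _ = 0

extend-toℕ : (a : Fin n → ℕ) (x : Fin n) → extend a (toℕ x) ≡ a x
extend-toℕ {n} a x with toℕ x <? n
... | yes x<n = cong a (fromℕ<-toℕ x x<n)
... | no x≮n = ⊥-elim (x≮n (toℕ<n x))

extend-n : (a : Fin n → ℕ) → extend a n ≡ 0
extend-n {n} a with n <? n
... | yes n<n = ⊥-elim (ℕ.<-irrefl refl n<n)
... | no _ = refl

-- With a 0 = 0, stepping from the last position back to 0 agrees with the padding by 0.
extend-next : (a : Fin (suc m) → ℕ) → a zero ≡ 0 → (x : Fin (suc m)) → a (next x) ≡ extend a (suc (toℕ x))
extend-next {m} a a₀≡0 x with suc (toℕ x) <? suc m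
... | yes _ = refl
... | no _ = a₀≡0

extend-sparse : (a : Fin (suc m) → ℕ) → a zero ≡ 0 → Sparse next a → Sparse (1 +_) (extend a)
extend-sparse {m} a a₀≡0 sparse i with i <? suc m
... | no _ = λ ()
... | yes i<n = subst (λ y → 0 < a x → 0 < y → a x + y ≤ 3) a[next-x]≡ (sparse x)
  where
  x = fromℕ< i<n
  a[next-x]≡ : a (next x) ≡ extend a (suc i)
  a[next-x]≡ = trans (extend-next a a₀≡0 x) (cong (extend a ∘ suc) (toℕ-fromℕ< i<n))

cycleWeight-from-zero : (a : Fin (2 + m) → ℕ) → a zero ≡ 0 → Sparse next a → cycleWeight a ≤ 3 * ⌊ 2 + m /2⌋
cycleWeight-from-zero {m} a a₀≡0 sparse = begin
  cycleWeight a                                     ≡⟨ cong₂ _+_ first-term (sum-cong-≗ other-terms) ⟩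
  pathWeight (suc m) (extend a)
    ≤⟨ pathWeight-≤ (suc m) (extend a) (extend-n a) (extend-sparse a a₀≡0 sparse) ⟩
  3 * ⌊ 2 + m /2⌋                                   ∎
  where
  open ℕ.≤-Reasoning
  first-term : weight (a (prev zero)) (a zero) (a (next zero)) ≡ 0
  first-term = cong (λ c → weight (a (prev zero)) c (a (next zero))) a₀≡0
  other-terms : ∀ y → weight (a (inject₁ y)) (a (suc y)) (a (next (suc y)))
                    ≡ weight (extend a (toℕ y)) (extend a (1 + toℕ y)) (extend a (2 + toℕ y))
  other-terms y = trans (cong₂ (λ l c → weight l c (a (next (suc y)))) left (sym (extend-toℕ a (suc y))))
                        (cong (weight _ _) (extend-next a a₀≡0 (suc y)))
    where
    left : a (inject₁ y) ≡ extend a (toℕ y)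
    left = sym (trans (cong (extend a) (sym (toℕ-inject₁ y))) (extend-toℕ a (inject₁ y)))

cycleWeight-with-zero : (a : Fin (2 + m) → ℕ) (z : Fin (2 + m)) → a z ≡ 0 → Sparse next a →
                        cycleWeight a ≤ 3 * ⌊ 2 + m /2⌋
cycleWeight-with-zero {m} a z = rotate (toℕ z) a z refl
  where
  rotate : ∀ j a z → toℕ z ≡ j → a z ≡ 0 → Sparse next a → cycleWeight a ≤ 3 * ⌊ 2 + m /2⌋
  rotate _ a zero _ = cycleWeight-from-zero a
  rotate (suc j) a (suc y) refl a[z]≡0 sparse =
    subst (_≤ 3 * ⌊ 2 + m /2⌋) (cycleWeight-rotate a)
      (rotate j (a ∘ next) (inject₁ y) (toℕ-inject₁ y) (trans (cong a (next-inject₁ y)) a[z]≡0) (sparse ∘ next))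

n≤1+3⌊n/2⌋ : ∀ n → n ≤ 1 + 3 * ⌊ n /2⌋
n≤1+3⌊n/2⌋ zero = z≤n
n≤1+3⌊n/2⌋ (suc zero) = ℕ.≤-refl
n≤1+3⌊n/2⌋ (suc (suc n)) = ℕ.≤-trans (s≤s (s≤s (n≤1+3⌊n/2⌋ n)))
  (ℕ.≤-trans (ℕ.n≤1+n _) (ℕ.≤-reflexive (cong suc (sym (ℕ.*-suc 3 ⌊ n /2⌋)))))

cycleWeight-positive : (a : Fin (2 + m) → ℕ) → (∀ x → 0 < a x) → (∀ x → a x ≤ 1) → cycleWeight a ≤ 3 * ⌊ 2 + m /2⌋
cycleWeight-positive {m} a positive ≤1 = begin
  cycleWeight a              ≤⟨ sum-mono-≤ term≤1 ⟩
  sum {2 + m} (λ _ → 1)      ≡⟨ trans (sum-const (2 + m) 1) (ℕ.*-identityʳ (2 + m)) ⟩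
  2 + m                      ≤⟨ s≤s (s≤s (n≤1+3⌊n/2⌋ m)) ⟩
  3 + 3 * ⌊ m /2⌋            ≡⟨ ℕ.*-suc 3 ⌊ m /2⌋ ⟨
  3 * ⌊ 2 + m /2⌋            ∎
  where
  open ℕ.≤-Reasoning
  term≤1 : ∀ x → weight (a (prev x)) (a x) (a (next x)) ≤ 1
  term≤1 x with a (next x) | positive (next x)
  ... | suc r | _ = subst (_≤ 1) (sym (weight-right-pos (a (prev x)) (a x) r)) (≤1 x)

cycleWeight-≤ : (a : Fin (2 + m) → ℕ) → Sparse next a → ((∀ x → 0 < a x) → ∀ x → a x ≤ 1) →
                cycleWeight a ≤ 3 * ⌊ 2 + m /2⌋
cycleWeight-≤ a sparse ≤1 with any? (λ x → a x ℕ.≟ 0)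
... | yes (z , a[z]≡0) = cycleWeight-with-zero a z a[z]≡0 sparse
... | no ¬zero = cycleWeight-positive a positive (≤1 positive)
  where
  positive : ∀ x → 0 < a x
  positive x = ℕ.n≢0⇒n>0 (λ a[x]≡0 → ¬zero (x , a[x]≡0))

-- Cliques of C̄_s ◇ C̄_t

module CliqueRows {k l : ℕ} {K : Fin (5 + k) × Fin (5 + l) → Set} (K? : ∀ v → Dec (K v))
  (clique : IsClique (coCycle (5 + k) ◇ coCycle (5 + l)) K) where

  private
    rows-differ : ∀ {x x' : Fin (5 + k)} {y y' : Fin (5 + l)} → x ≢ x' → (x , y) ≢ (x' , y')
    rows-differ x≢x' e = x≢x' (cong proj₁ e)

    columns-differ : ∀ {x x' : Fin (5 + k)} {y y' : Fin (5 + l)} → y ≢ y' → (x , y) ≢ (x' , y')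
    columns-differ y≢y' e = y≢y' (cong proj₂ e)

  near-rows⇒near-columns : ∀ {x x' y y'} → CycAdj _ x x' → K (x , y) → K (x' , y') → CycAdj _ y y'
  near-rows⇒near-columns c p q = Adj-near-rows (clique p q (rows-differ λ { refl → CycAdj-irrefl c })) c

  near-columns⇒near-rows : ∀ {x x' y y'} → CycAdj _ y y' → K (x , y) → K (x' , y') → CycAdj _ x x'
  near-columns⇒near-rows c p q = Adj-near-columns (clique p q (columns-differ λ { refl → CycAdj-irrefl c })) c

  far-rows⇒¬near-columns : ∀ {x x' y y'} → Far x x' → K (x , y) → K (x' , y') → ¬ CycAdj _ y y'
  far-rows⇒¬near-columns f p q = Adj-far-rows (clique p q (rows-differ (proj₁ f))) f

  rowCount : Fin (5 + k) → ℕ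
  rowCount x = count (λ y → K? (x , y))

  columnCount : Fin (5 + l) → ℕ
  columnCount y = count (λ x → K? (x , y))

  row-≤2 : ∀ {x x'} → CycAdj _ x x' → 0 < rowCount x' → rowCount x ≤ 2
  row-≤2 {x} {x'} c pos with count>0⇒∃ (λ y → K? (x' , y)) pos
  ... | y' , q = neighbours-≤2 (λ y → K? (x , y)) y' (λ p → CycAdj-sym (near-rows⇒near-columns c p q))

  row-≤1 : ∀ {x x'} → CycAdj _ x x' → 2 ≤ rowCount x' → rowCount x ≤ 1
  row-≤1 {x} {x'} c two with count≥2⇒distinct (λ y → K? (x' , y)) two
  ... | b₁ , b₂ , q₁ , q₂ , b₁≢b₂ = count-≤1 (λ y → K? (x , y)) λ p p' →
    common-neighbour-unique b₁≢b₂ (column-near p q₁) (column-near p' q₁) (column-near p q₂) (column-near p' q₂)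
    where
    column-near : ∀ {y b} → K (x , y) → K (x' , b) → CycAdj _ b y
    column-near p q = CycAdj-sym (near-rows⇒near-columns c p q)

  rows-sparse : Sparse next rowCount
  rows-sparse x pos pos' with 2 ℕ.≤? rowCount x
  ... | yes two = ℕ.+-mono-≤ (row-≤2 (CycAdj-next x) pos') (row-≤1 (CycAdj-sym (CycAdj-next x)) two)
  ... | no ¬two = ℕ.+-mono-≤ (ℕ.≤-pred (ℕ.≰⇒> ¬two)) (row-≤2 (CycAdj-sym (CycAdj-next x)) pos)

  -- Two cells in row x force the cells chosen in rows x - 1 and x + 1 into one column, which is
  -- then near the column of the cell in row x + 2 although rows x - 1 and x + 2 are far.
  no-empty-row⇒row-≤1 : (∀ x → 0 < rowCount x) → ∀ x → rowCount x ≤ 1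
  no-empty-row⇒row-≤1 pos x with 2 ℕ.≤? rowCount x
  ... | no ¬two = ℕ.≤-pred (ℕ.≰⇒> ¬two)
  ... | yes two with count≥2⇒distinct (λ y → K? (x , y)) two
  ...   | b₁ , b₂ , p₁ , p₂ , b₁≢b₂ =
    ⊥-elim (far-rows⇒¬near-columns (Step³⇒Far (Step-prev x) (Step-next x) (Step-next (next x))) q₀ q₃
                                   (subst (λ c → CycAdj _ c d) (sym c₀≡c₂) c₂~d))
    where
    point : ∀ x' → ∃ λ y → K (x' , y)
    point x' = count>0⇒∃ (λ y → K? (x' , y)) (pos x')
    c₀ = proj₁ (point (prev x))
    q₀ = proj₂ (point (prev x))
    c₂ = proj₁ (point (next x))
    q₂ = proj₂ (point (next x))
    d = proj₁ (point (next (next x)))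
    q₃ = proj₂ (point (next (next x)))
    c₀≡c₂ : c₀ ≡ c₂
    c₀≡c₂ = common-neighbour-unique b₁≢b₂
      (near-rows⇒near-columns (CycAdj-prev x) p₁ q₀) (near-rows⇒near-columns (CycAdj-next x) p₁ q₂)
      (near-rows⇒near-columns (CycAdj-prev x) p₂ q₀) (near-rows⇒near-columns (CycAdj-next x) p₂ q₂)
    c₂~d : CycAdj _ c₂ d
    c₂~d = near-rows⇒near-columns (CycAdj-next (next x)) q₂ q₃

  rowWeight-≤ : cycleWeight rowCount ≤ 3 * ⌊ 5 + k /2⌋
  rowWeight-≤ = cycleWeight-≤ rowCount rows-sparse no-empty-row⇒row-≤1

  rowIsolated : Fin (5 + k) → ℕ
  rowIsolated = isolatedAt rowCount

  rowIsolated-≤1 : ∀ x → rowIsolated x ≤ 1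
  rowIsolated-≤1 x = isolated-≤1 (rowCount (prev x)) (rowCount x) (rowCount (next x))

  isolatedRows : ℕ
  isolatedRows = sum rowIsolated

  pointsInIsolatedRows : ℕ
  pointsInIsolatedRows = sum (λ x → rowCount x * rowIsolated x)

  isolatedRows-≤ : isolatedRows ≤ ⌊ 5 + k /2⌋
  isolatedRows-≤ = ℕ.*-cancelˡ-≤ 3 (ℕ.≤-trans (3*isolated≤cycleWeight rowCount) rowWeight-≤)

  isolated-row⇒empty-columns : ∀ {x y} → K (x , y) → rowCount (prev x) ≡ 0 → rowCount (next x) ≡ 0 →
                               columnCount (prev y) ≡ 0 × columnCount (next y) ≡ 0
  isolated-row⇒empty-columns {x} {y} p prev-empty next-empty =
    empty (CycAdj-prev y) , empty (CycAdj-next y)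
    where
    empty : ∀ {y'} → CycAdj _ y y' → columnCount y' ≡ 0
    empty {y'} c = count-∅ (λ x' q → neighbour-row-empty (CycAdj⇒next⊎prev (near-columns⇒near-rows c p q)) q)
                           (λ x' → K? (x' , y'))
      where
      neighbour-row-empty : ∀ {x'} → x' ≡ next x ⊎ x' ≡ prev x → ¬ K (x' , y')
      neighbour-row-empty (inj₁ refl) q = ℕ.<⇒≢ (∃⇒count>0 (λ y → K? (next x , y)) q) (sym next-empty)
      neighbour-row-empty (inj₂ refl) q = ℕ.<⇒≢ (∃⇒count>0 (λ y → K? (prev x , y)) q) (sym prev-empty)

clique-arithmetic : ∀ {K ρ γ S T} → ρ ≤ S → γ ≤ T → 3 ≤ T → K + 3 * ρ ≤ 3 * S + ρ * γ → K ≤ S * T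
clique-arithmetic {K} {ρ} {γ} {S} {T} ρ≤S γ≤T 3≤T K+3ρ≤ = begin
  K              ≤⟨ ℕ.+-cancelˡ-≤ (3 * ρ) K (3 * d + ρ * T) shifted ⟩
  3 * d + ρ * T  ≤⟨ ℕ.+-monoˡ-≤ (ρ * T) (ℕ.*-monoˡ-≤ d 3≤T) ⟩
  T * d + ρ * T  ≡⟨ cong (_+ ρ * T) (ℕ.*-comm T d) ⟩
  d * T + ρ * T  ≡⟨ ℕ.*-distribʳ-+ T d ρ ⟨
  (d + ρ) * T    ≡⟨ cong (_* T) (trans (ℕ.+-comm d ρ) ρ+d≡S) ⟩
  S * T          ∎
  where
  open ℕ.≤-Reasoning
  d = S ∸ ρ
  ρ+d≡S : ρ + d ≡ S
  ρ+d≡S = ℕ.m+[n∸m]≡n ρ≤S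
  shifted : 3 * ρ + K ≤ 3 * ρ + (3 * d + ρ * T)
  shifted = begin
    3 * ρ + K              ≡⟨ ℕ.+-comm (3 * ρ) K ⟩
    K + 3 * ρ              ≤⟨ K+3ρ≤ ⟩
    3 * S + ρ * γ          ≤⟨ ℕ.+-monoʳ-≤ (3 * S) (ℕ.*-monoʳ-≤ ρ γ≤T) ⟩
    3 * S + ρ * T          ≡⟨ cong (λ s → 3 * s + ρ * T) ρ+d≡S ⟨
    3 * (ρ + d) + ρ * T    ≡⟨ cong (_+ ρ * T) (ℕ.*-distribˡ-+ 3 ρ d) ⟩
    (3 * ρ + 3 * d) + ρ * T ≡⟨ ℕ.+-assoc (3 * ρ) (3 * d) (ρ * T) ⟩
    3 * ρ + (3 * d + ρ * T) ∎

n≤1⇒n≤n*n : ∀ {n} → n ≤ 1 → n ≤ n * n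
n≤1⇒n≤n*n {zero} _ = z≤n
n≤1⇒n≤n*n {suc zero} _ = ℕ.≤-refl
n≤1⇒n≤n*n {suc (suc _)} (s≤s ())

module CliqueBound {k l : ℕ} {K : Fin (5 + k) × Fin (5 + l) → Set} (K? : ∀ v → Dec (K v))
  (clique : IsClique (coCycle (5 + k) ◇ coCycle (5 + l)) K) where

  Kᵀ? : ∀ v → Dec (K (swap v))
  Kᵀ? v = K? (swap v)

  cliqueᵀ : ∀ {u v} → K (swap u) → K (swap v) → u ≢ v → Adj (coCycle (5 + l) ◇ coCycle (5 + k)) u v
  cliqueᵀ p q u≢v = Adj-transpose (clique p q (u≢v ∘ cong swap))

  count₂-transpose : count₂ Kᵀ? ≡ count₂ K?
  count₂-transpose = sym (∑-comm (λ x y → χ (K? (x , y))))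

  module R = CliqueRows K? clique
  module C = CliqueRows Kᵀ? cliqueᵀ

  isolated-row⇔isolated-column : ∀ {x y} → K (x , y) → R.rowIsolated x ≡ C.rowIsolated y
  isolated-row⇔isolated-column {x} {y} p = begin
    R.rowIsolated x
      ≡⟨ isolated-positive _ _ _ (∃⇒count>0 (λ y → K? (x , y)) p) ⟩
    χ ((R.rowCount (prev x) ℕ.≟ 0) ×-dec (R.rowCount (next x) ℕ.≟ 0))
      ≡⟨ χ-cong (uncurry (R.isolated-row⇒empty-columns p)) (uncurry (C.isolated-row⇒empty-columns p)) _ _ ⟩
    χ ((C.rowCount (prev y) ℕ.≟ 0) ×-dec (C.rowCount (next y) ℕ.≟ 0))
      ≡⟨ isolated-positive _ _ _ (∃⇒count>0 (λ x → K? (x , y)) p) ⟨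
    C.rowIsolated y
      ∎
    where open ≡-Reasoning

  pointsInIsolatedRows-≤ : R.pointsInIsolatedRows ≤ R.isolatedRows * C.isolatedRows
  pointsInIsolatedRows-≤ = begin
    sum (λ x → R.rowCount x * R.rowIsolated x)
      ≡⟨ sum-cong-≗ (λ x → *-distribʳ-sum (R.rowIsolated x) (λ y → χ (K? (x , y)))) ⟩
    sum (λ x → sum (λ y → χ (K? (x , y)) * R.rowIsolated x))
      ≤⟨ sum-mono-≤ (λ x → sum-mono-≤ (λ y → both-isolated (K? (x , y)))) ⟩
    sum (λ x → sum (λ y → R.rowIsolated x * C.rowIsolated y))
      ≡⟨ sum-cong-≗ (λ x → *-distribˡ-sum (R.rowIsolated x) C.rowIsolated) ⟨
    sum (λ x → R.rowIsolated x * C.isolatedRows)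
      ≡⟨ *-distribʳ-sum C.isolatedRows R.rowIsolated ⟨
    R.isolatedRows * C.isolatedRows
      ∎
    where
    open ℕ.≤-Reasoning
    both-isolated : ∀ {x y} (p : Dec (K (x , y))) → χ p * R.rowIsolated x ≤ R.rowIsolated x * C.rowIsolated y
    both-isolated (no _) = z≤n
    both-isolated {x} {y} (yes p) =
      subst (λ i → 1 * R.rowIsolated x ≤ R.rowIsolated x * i) (isolated-row⇔isolated-column p)
            (ℕ.≤-trans (ℕ.≤-reflexive (ℕ.*-identityˡ (R.rowIsolated x))) (n≤1⇒n≤n*n (R.rowIsolated-≤1 x)))

  bound : 3 ≤ ⌊ 5 + l /2⌋ → count₂ K? ≤ ⌊ 5 + k /2⌋ * ⌊ 5 + l /2⌋
  bound 3≤T = clique-arithmetic R.isolatedRows-≤ C.isolatedRows-≤ 3≤T (begin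
    count₂ K? + 3 * R.isolatedRows                    ≡⟨ cycleWeight-+-isolated R.rowCount ⟨
    cycleWeight R.rowCount + R.pointsInIsolatedRows   ≤⟨ ℕ.+-mono-≤ R.rowWeight-≤ pointsInIsolatedRows-≤ ⟩
    3 * ⌊ 5 + k /2⌋ + R.isolatedRows * C.isolatedRows ∎)
    where open ℕ.≤-Reasoning

clique-bound : ∀ {k l} {K : Fin (5 + k) × Fin (5 + l) → Set} (K? : ∀ v → Dec (K v)) →
               IsClique (coCycle (5 + k) ◇ coCycle (5 + l)) K →
               3 ≤ ⌊ 5 + k /2⌋ ⊎ 3 ≤ ⌊ 5 + l /2⌋ → count₂ K? ≤ ⌊ 5 + k /2⌋ * ⌊ 5 + l /2⌋
clique-bound K? clique (inj₂ 3≤T) = CliqueBound.bound K? clique 3≤T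
clique-bound {k} {l} K? clique (inj₁ 3≤S) = begin
  count₂ K?                    ≡⟨ count₂-transpose ⟨
  count₂ Kᵀ?                   ≤⟨ CliqueBound.bound Kᵀ? cliqueᵀ 3≤S ⟩
  ⌊ 5 + l /2⌋ * ⌊ 5 + k /2⌋    ≡⟨ ℕ.*-comm ⌊ 5 + l /2⌋ ⌊ 5 + k /2⌋ ⟩
  ⌊ 5 + k /2⌋ * ⌊ 5 + l /2⌋    ∎
  where
  open ℕ.≤-Reasoning
  open CliqueBound K? clique using (Kᵀ?; cliqueᵀ; count₂-transpose)

-- Strong metric dimension from cliques

module _ {k l : ℕ} where

  private
    G = coCycle (5 + k) ◇ coCycle (5 + l)
    Cell = Fin (5 + k) × Fin (5 + l)
    cells = cartesianProduct (allFin (5 + k)) (allFin (5 + l))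

  open Diameter₂ G _≟₂_ Adj? Adj-sym Adj-irrefl common-neighbour public
  open import Data.List.Membership.DecPropositional (_≟₂_ {5 + k} {5 + l}) using (_∈?_)

  strongResolvingSet-from-clique : {K : Cell → Set} (K? : ∀ v → Dec (K v)) → IsClique G K →
    (∀ {u v} → K u → K v → u ≢ v → HasNeighbourOutside u v) →
    Σ (List Cell) λ S → Unique S × StrongResolvingSet G S × length S ≡ (5 + k) * (5 + l) ∸ count₂ K?
  strongResolvingSet-from-clique K? clique outside =
    S , unique , complement-resolving cells ∈-cells K? clique outside , length-S
    where
    S = filter (¬? ∘ K?) cells
    ∈-cells : ∀ v → v ∈ cells
    ∈-cells (x , y) = ∈-cartesianProduct⁺ (∈-allFin x) (∈-allFin y)
    unique : Unique S
    unique = filter⁺ (¬? ∘ K?) (cartesianProduct⁺ (allFin⁺ (5 + k)) (allFin⁺ (5 + l)))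
    length-S : length S ≡ (5 + k) * (5 + l) ∸ count₂ K?
    length-S = begin
      length S                                       ≡⟨ count₂-∈ S unique ⟨
      count₂ (_∈? S)
        ≡⟨ count₂-cong (proj₂ ∘ ∈-filter⁻ (¬? ∘ K?)) (∈-filter⁺ (¬? ∘ K?) (∈-cells _)) (_∈? S) (¬? ∘ K?) ⟩
      count₂ (¬? ∘ K?)                               ≡⟨ ℕ.m+n∸m≡n (count₂ K?) (count₂ (¬? ∘ K?)) ⟨
      count₂ K? + count₂ (¬? ∘ K?) ∸ count₂ K?       ≡⟨ cong (_∸ count₂ K?) (count₂-complement K?) ⟩
      (5 + k) * (5 + l) ∸ count₂ K?                  ∎
      where open ≡-Reasoning

  strongResolvingSet-lower-bound : ∀ B → (∀ {K : Cell → Set} (K? : ∀ v → Dec (K v)) → IsClique G K → count₂ K? ≤ B) →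
    ∀ S → Unique S → StrongResolvingSet G S → (5 + k) * (5 + l) ∸ B ≤ length S
  strongResolvingSet-lower-bound B bound S unique resolving =
    ℕ.m≤n+o⇒m∸n≤o _ B (begin
      (5 + k) * (5 + l)                            ≡⟨ count₂-complement (_∈? S) ⟨
      count₂ (_∈? S) + count₂ (¬? ∘ (_∈? S))       ≡⟨ ℕ.+-comm (count₂ (_∈? S)) _ ⟩
      count₂ (¬? ∘ (_∈? S)) + count₂ (_∈? S)       ≤⟨ ℕ.+-mono-≤ (bound (¬? ∘ (_∈? S)) (complement-is-clique resolving))
                                                                  (ℕ.≤-reflexive (count₂-∈ S unique)) ⟩
      B + length S                                 ∎)
    where open ℕ.≤-Reasoning

  strongMetricDim-from-clique : ∀ B {K : Cell → Set} (K? : ∀ v → Dec (K v)) → IsClique G K →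
    (∀ {u v} → K u → K v → u ≢ v → HasNeighbourOutside u v) → count₂ K? ≡ B →
    (∀ {K′ : Cell → Set} (K′? : ∀ v → Dec (K′ v)) → IsClique G K′ → count₂ K′? ≤ B) →
    IsStrongMetricDim G ((5 + k) * (5 + l) ∸ B)
  strongMetricDim-from-clique B K? clique outside |K|≡B maximum =
    resize (strongResolvingSet-from-clique K? clique outside) , strongResolvingSet-lower-bound B maximum
    where
    resize : Σ (List Cell) (λ S → Unique S × StrongResolvingSet G S × length S ≡ (5 + k) * (5 + l) ∸ count₂ K?) →
             Σ (List Cell) (λ S → Unique S × StrongResolvingSet G S × length S ≡ (5 + k) * (5 + l) ∸ B)
    resize (S , unique , resolving , length-S) =
      S , unique , resolving , trans length-S (cong ((5 + k) * (5 + l) ∸_) |K|≡B)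

-- Extremal cliques

even : ℕ → Bool
even zero = true
even (suc zero) = false
even (suc (suc n)) = even n

even⇒odd : ∀ a → T (even a) → ¬ T (even (suc a))
even⇒odd zero _ ()
even⇒odd (suc (suc a)) = even⇒odd a

-- The last position n - 1 is excluded because for odd n it is even and adjacent to 0.
EvenPos : Fin n → Set
EvenPos {n} x = T (even (toℕ x)) × suc (toℕ x) < n

EvenPos? : (x : Fin n) → Dec (EvenPos x)
EvenPos? {n} x = T? (even (toℕ x)) ×-dec (suc (toℕ x) <? n)

EvenPos-far : {x x' : Fin n} → EvenPos x → EvenPos x' → x ≢ x' → Far x x'
EvenPos-far {x = x} {x'} (ex , x<n) (ex' , x'<n) x≢x' = x≢x' , not-adjacent
  where
  not-adjacent : ¬ CycAdj _ x x'
  not-adjacent (inj₁ e) = even⇒odd (toℕ x) ex (subst (T ∘ even) e ex')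
  not-adjacent (inj₂ (inj₁ e)) = even⇒odd (toℕ x') ex' (subst (T ∘ even) e ex)
  not-adjacent (inj₂ (inj₂ (inj₁ (_ , e)))) = ℕ.<-irrefl e x'<n
  not-adjacent (inj₂ (inj₂ (inj₂ (_ , e)))) = ℕ.<-irrefl e x<n

EvenCell : Fin m × Fin n → Set
EvenCell (x , y) = EvenPos x × EvenPos y

EvenCell? : (v : Fin m × Fin n) → Dec (EvenCell v)
EvenCell? (x , y) = EvenPos? x ×-dec EvenPos? y

count-EvenPos : ∀ n → count (EvenPos? {n}) ≡ ⌊ n /2⌋
count-EvenPos zero = refl
count-EvenPos (suc zero) = refl
count-EvenPos (suc (suc n)) = cong suc (trans
  (count-cong (λ { (e , s≤s (s≤s lt)) → e , lt }) (λ { (e , lt) → e , s≤s (s≤s lt) })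
              (λ x → EvenPos? {2 + n} (suc (suc x))) EvenPos?)
  (count-EvenPos n))

module _ {k l : ℕ} where

  private
    G = coCycle (5 + k) ◇ coCycle (5 + l)

  even-cells-clique : IsClique G EvenCell
  even-cells-clique {x , y} {x' , y'} (ex , ey) (ex' , ey') u≢v with x ≟ x' | y ≟ y'
  ... | yes refl | yes refl = ⊥-elim (u≢v refl)
  ... | yes refl | no y≢y' = Compatible⇒Adj (same refl) (far (EvenPos-far ey ey' y≢y')) tt
  ... | no x≢x' | yes refl = Compatible⇒Adj (far (EvenPos-far ex ex' x≢x')) (same refl) tt
  ... | no x≢x' | no y≢y' = Compatible⇒Adj (far (EvenPos-far ex ex' x≢x')) (far (EvenPos-far ey ey' y≢y')) tt

  even-cells-outside : ∀ {u v} → EvenCell u → EvenCell v → u ≢ v → HasNeighbourOutside {k} {l} u v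
  even-cells-outside {x , y} {x' , y'} (ex , ey) (ex' , ey') u≢v with y ≟ y'
  ... | no y≢y' with far-neighbour (EvenPos-far ey ey' y≢y')
  ...   | z , y'~z , far-y-z =
    (x , z) , Compatible⇒Adj (same refl) (far far-y-z) tt ,
    (λ e → CycAdj-irrefl (subst (CycAdj _ y') (cong proj₂ e) y'~z)) ,
    λ a → rows-not-near (x' ≟ x) (Adj-near-columns a y'~z)
    where
    rows-not-near : Dec (x' ≡ x) → ¬ CycAdj _ x' x
    rows-not-near (yes refl) = CycAdj-irrefl
    rows-not-near (no x'≢x) = proj₂ (EvenPos-far ex' ex x'≢x)
  even-cells-outside {x , y} {x' , y'} (ex , ey) (ex' , ey') u≢v | yes refl
    with far-neighbour (EvenPos-far ex ex' (λ { refl → u≢v refl }))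
  ... | z , x'~z , far-x-z =
    (z , y) , Compatible⇒Adj (far far-x-z) (same refl) tt ,
    (λ e → CycAdj-irrefl (subst (CycAdj _ x') (cong proj₁ e) x'~z)) ,
    λ a → CycAdj-irrefl (Adj-near-rows a x'~z)

  count₂-even-cells : count₂ (EvenCell? {5 + k} {5 + l}) ≡ ⌊ 5 + k /2⌋ * ⌊ 5 + l /2⌋
  count₂-even-cells = trans (count₂-× (EvenPos? {5 + k}) (EvenPos? {5 + l}))
                            (cong₂ _*_ (count-EvenPos (5 + k)) (count-EvenPos (5 + l)))

module _ {k : ℕ} where

  private
    G = coCycle (5 + k) ◇ coCycle (5 + k)

  diagonal-clique : IsClique G (λ v → proj₁ v ≡ proj₂ v)
  diagonal-clique {x , .x} {x' , .x'} refl refl u≢v with kindOf x x'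
  ... | _ , same refl = ⊥-elim (u≢v refl)
  ... | _ , near c = Compatible⇒Adj (near c) (near c) tt
  ... | _ , far f = Compatible⇒Adj (far f) (far f) tt

  diagonal-outside : ∀ {u v} → proj₁ u ≡ proj₂ u → proj₁ v ≡ proj₂ v → u ≢ v → HasNeighbourOutside {k} {k} u v
  diagonal-outside {x , .x} {x' , .x'} refl refl u≢v with kindOf x x'
  ... | _ , same refl = ⊥-elim (u≢v refl)
  ... | _ , near c with far-from-edge c
  ...   | z , far-x-z , far-x'-z =
    (x , z) , Compatible⇒Adj (same refl) (far far-x-z) tt , (λ e → u≢v (cong (λ x → x , x) (cong proj₁ e))) ,
    λ a → proj₂ far-x'-z (Adj-near-rows a (CycAdj-sym c))
  diagonal-outside {x , .x} {x' , .x'} refl refl u≢v | _ , far f with far-neighbour f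
  ...   | z , x'~z , far-x-z =
    (x , z) , Compatible⇒Adj (same refl) (far far-x-z) tt , (λ e → u≢v (cong (λ x → x , x) (cong proj₁ e))) ,
    λ a → proj₂ f (CycAdj-sym (Adj-near-columns a x'~z))

  count₂-diagonal : count₂ {5 + k} {5 + k} (λ v → proj₁ v ≟ proj₂ v) ≡ 5 + k
  count₂-diagonal = begin
    sum {5 + k} (λ x → count (x ≟_)) ≡⟨ sum-cong-≗ (count-≡˘ {5 + k}) ⟩
    sum {5 + k} (λ _ → 1)      ≡⟨ sum-const (5 + k) 1 ⟩
    (5 + k) * 1                ≡⟨ ℕ.*-identityʳ (5 + k) ⟩
    5 + k                      ∎
    where open ≡-Reasoning

colour : Fin 5 × Fin 5 → Fin 5
colour (x , y) = (toℕ y + 3 * toℕ x) mod 5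

-- Cells of one colour differ by (d , 2d) modulo 5, so their row and column kinds are
-- (near, far) or (far, near).
same-colour⇒¬Adj : ∀ x y x' y' → colour (x , y) ≡ colour (x' , y') → (x , y) ≢ (x' , y') →
                   ¬ Adj (coCycle 5 ◇ coCycle 5) (x , y) (x' , y')
same-colour⇒¬Adj = from-yes (all? λ x → all? λ y → all? λ x' → all? λ y' →
  (colour (x , y) ≟ colour (x' , y')) →-dec ¬? ((x , y) ≟₂ (x' , y')) →-dec ¬? (Adj? (x , y) (x' , y')))

clique-≤5 : ∀ {K : Fin 5 × Fin 5 → Set} (K? : ∀ v → Dec (K v)) → IsClique (coCycle 5 ◇ coCycle 5) K → count₂ K? ≤ 5
clique-≤5 K? clique = count₂-≤-colouring K? colour injective
  where
  injective : ∀ {u v} → _ → _ → colour u ≡ colour v → u ≡ v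
  injective {x , y} {x' , y'} p q e =
    decidable-stable ((x , y) ≟₂ (x' , y')) (λ u≢v → same-colour⇒¬Adj x y x' y' e u≢v (clique p q u≢v))

6≤m⊔n⇒3≤⌊m/2⌋⊎3≤⌊n/2⌋ : ∀ m n → 6 ≤ m ⊔ n → 3 ≤ ⌊ m /2⌋ ⊎ 3 ≤ ⌊ n /2⌋
6≤m⊔n⇒3≤⌊m/2⌋⊎3≤⌊n/2⌋ m n 6≤m⊔n with ℕ.⊔-sel m n
... | inj₁ m⊔n≡m = inj₁ (ℕ.⌊n/2⌋-mono (subst (6 ≤_) m⊔n≡m 6≤m⊔n))
... | inj₂ m⊔n≡n = inj₂ (ℕ.⌊n/2⌋-mono (subst (6 ≤_) m⊔n≡n 6≤m⊔n))

strongMetricDim-coCycle◇coCycle : ∀ k l → 3 ≤ ⌊ 5 + k /2⌋ ⊎ 3 ≤ ⌊ 5 + l /2⌋ →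
  IsStrongMetricDim (coCycle (5 + k) ◇ coCycle (5 + l)) ((5 + k) * (5 + l) ∸ ⌊ 5 + k /2⌋ * ⌊ 5 + l /2⌋)
strongMetricDim-coCycle◇coCycle k l three =
  strongMetricDim-from-clique _ EvenCell?
    even-cells-clique even-cells-outside count₂-even-cells (λ K? clique → clique-bound K? clique three)

strongMetricDim-coCycle5◇coCycle5 : IsStrongMetricDim (coCycle 5 ◇ coCycle 5) 20
strongMetricDim-coCycle5◇coCycle5 =
  strongMetricDim-from-clique 5 (λ v → proj₁ v ≟ proj₂ v) diagonal-clique diagonal-outside count₂-diagonal clique-≤5

proposition4p6 :
    ((s t : ℕ) → 5 ≤ s → 5 ≤ t → 6 ≤ s ⊔ t →
       IsStrongMetricDim (coCycle s ◇ coCycle t) (s * t ∸ ⌊ s /2⌋ * ⌊ t /2⌋))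
    × IsStrongMetricDim (coCycle 5 ◇ coCycle 5) 20
proposition4p6 = general , strongMetricDim-coCycle5◇coCycle5
  where
  general : (s t : ℕ) → 5 ≤ s → 5 ≤ t → 6 ≤ s ⊔ t →
            IsStrongMetricDim (coCycle s ◇ coCycle t) (s * t ∸ ⌊ s /2⌋ * ⌊ t /2⌋)
  general s t 5≤s 5≤t 6≤s⊔t with ℕ.m≤n⇒∃[o]m+o≡n 5≤s | ℕ.m≤n⇒∃[o]m+o≡n 5≤t
  ... | k , refl | l , refl = strongMetricDim-coCycle◇coCycle k l (6≤m⊔n⇒3≤⌊m/2⌋⊎3≤⌊n/2⌋ s t 6≤s⊔t)
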